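{- Let $n$ be even, let $\pi$ be a fixed-point-free involution of $[n]$, and let $H_\pi$ be the interval graph whose vertices are the $n/2$ intervals $[i,\pi(i)]$ with $1\le i\le n$, $i<\pi(i)$, two distinct intervals being adjacent iff they intersect. If $H_\pi$ has $l$ edges, then ${\sf cut}(\pi)\ge l/n$.
   Context: For $1\le i\le n$, $C_i(\pi)$ is the set of transpositions $\{j,\pi(j)\}$ of $\pi$ with $\min(j,\pi(j))\le i\le\max(j,\pi(j))$, and ${\sf cut}(\pi)=\max_{1\le k\le n}|C_k(\pi)|$. -}

module Defs where

open import Data.Nat using (ℕ; _⊔_; _≤_; _<_)
open import Data.Nat.Properties using (_≤?_; _<?_)
open import Data.Fin using (Fin; toℕ)
open import Data.List using (List; length; filter; allFin; foldr; map; cartesianProduct)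
open import Data.Product using (_×_; _,_; proj₁; proj₂)
open import Relation.Nullary using (Dec)
open import Relation.Nullary.Decidable using (_×-dec_)
open import Relation.Binary.PropositionalEquality using (_≡_; _≢_)

-- Points of [n] are represented by Fin n (i ↦ i+1); ordering via toℕ.

IsInvolution : ∀ {n} → (Fin n → Fin n) → Set
IsInvolution {n} π = ∀ (i : Fin n) → π (π i) ≡ i

FixedPointFree : ∀ {n} → (Fin n → Fin n) → Set
FixedPointFree {n} π = ∀ (i : Fin n) → π i ≢ i

-- j is the left endpoint of a transposition {j, π j}, i.e. j < π j.
-- Each transposition {j,π j} is counted exactly once via its smaller element j.
-- j ∈ C_k  iff  j < π j  and  j ≤ k ≤ π j.
InC : ∀ {n} → (Fin n → Fin n) → Fin n → Fin n → Set
InC π k j = (toℕ j < toℕ (π j)) × ((toℕ j ≤ toℕ k) × (toℕ k ≤ toℕ (π j)))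

inC? : ∀ {n} (π : Fin n → Fin n) (k j : Fin n) → Dec (InC π k j)
inC? π k j = (toℕ j <? toℕ (π j)) ×-dec ((toℕ j ≤? toℕ k) ×-dec (toℕ k ≤? toℕ (π j)))

cardC : ∀ {n} → (Fin n → Fin n) → Fin n → ℕ
cardC {n} π k = length (filter (inC? π k) (allFin n))

cut : ∀ {n} → (Fin n → Fin n) → ℕ
cut {n} π = foldr _⊔_ 0 (map (cardC π) (allFin n))

-- Distinct intervals have distinct left
-- endpoints, so each edge is counted once as a pair with i < j; the intervals
-- then intersect iff j ≤ π i.
IsEdge : ∀ {n} → (Fin n → Fin n) → Fin n × Fin n → Set
IsEdge π (i , j) =
  (toℕ i < toℕ (π i)) × ((toℕ j < toℕ (π j)) × ((toℕ i < toℕ j) × (toℕ j ≤ toℕ (π i))))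

isEdge? : ∀ {n} (π : Fin n → Fin n) (e : Fin n × Fin n) → Dec (IsEdge π e)
isEdge? π (i , j) =
  (toℕ i <? toℕ (π i)) ×-dec ((toℕ j <? toℕ (π j)) ×-dec
    ((toℕ i <? toℕ j) ×-dec (toℕ j ≤? toℕ (π i))))

edges : ∀ {n} → (Fin n → Fin n) → ℕ
edges {n} π = length (filter (isEdge? π) (cartesianProduct (allFin n) (allFin n)))

module Submission where

-- Double counting.  Every edge of H_π is recorded in Defs as a pair (i , j)
-- with i < j ≤ π i and i < π i, j < π j; such a pair says that the
-- transposition {i , π i} crosses the point j, i.e. i ∈ C_j(π).  The map
-- (i , j) ↦ (j , i) therefore embeds the edges into the incidences
-- "i ∈ C_j", whence
--   edges π  ≤  Σ_j |C_j(π)|  ≤  n · max_j |C_j(π)|  =  n · cut π.  The bound holds for every map π : Fin n → Fin n.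

open import Defs
open import Data.Nat using (ℕ; _*_; _≤_; _+_; _⊔_; suc; z≤n)
open import Data.Nat.Properties
open import Algebra.Properties.CommutativeSemigroup +-commutativeSemigroup using (interchange)
open import Data.Fin using (Fin)
open import Data.List using (List; []; _∷_; _++_; map; length; filter; allFin; foldr; cartesianProduct)
open import Data.List.Properties using (length-tabulate)
open import Data.Product using (_×_; _,_)
open import Function using (id)
open import Relation.Nullary using (Dec; yes; no; contradiction)
open import Relation.Binary.PropositionalEquality using (_≡_; refl; sym; cong; cong₂; module ≡-Reasoning)

private
  variable
    A B : Set

∑ : List A → (A → ℕ) → ℕ
∑ [] f = 0
∑ (x ∷ xs) f = f x + ∑ xs f

𝟙 : {P : Set} → Dec P → ℕ
𝟙 (yes _) = 1
𝟙 (no _) = 0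

length-filter≡∑𝟙 : {P : A → Set} (P? : ∀ x → Dec (P x)) (xs : List A) →
                   length (filter P? xs) ≡ ∑ xs (λ x → 𝟙 (P? x))
length-filter≡∑𝟙 P? [] = refl
length-filter≡∑𝟙 P? (x ∷ xs) with P? x
... | yes _ = cong suc (length-filter≡∑𝟙 P? xs)
... | no _ = length-filter≡∑𝟙 P? xs

𝟙-mono : {P Q : Set} (P? : Dec P) (Q? : Dec Q) → (P → Q) → 𝟙 P? ≤ 𝟙 Q?
𝟙-mono (yes _) (yes _) _ = ≤-refl
𝟙-mono (yes p) (no ¬q) P⇒Q = contradiction (P⇒Q p) ¬q
𝟙-mono (no _) _ _ = z≤n

∑-cong : (xs : List A) {f g : A → ℕ} → (∀ x → f x ≡ g x) → ∑ xs f ≡ ∑ xs g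
∑-cong [] f≡g = refl
∑-cong (x ∷ xs) f≡g = cong₂ _+_ (f≡g x) (∑-cong xs f≡g)

∑-mono : (xs : List A) {f g : A → ℕ} → (∀ x → f x ≤ g x) → ∑ xs f ≤ ∑ xs g
∑-mono [] f≤g = z≤n
∑-mono (x ∷ xs) f≤g = +-mono-≤ (f≤g x) (∑-mono xs f≤g)

∑-++ : (xs ys : List A) (f : A → ℕ) → ∑ (xs ++ ys) f ≡ ∑ xs f + ∑ ys f
∑-++ [] ys f = refl
∑-++ (x ∷ xs) ys f = begin
  f x + ∑ (xs ++ ys) f     ≡⟨ cong (f x +_) (∑-++ xs ys f) ⟩
  f x + (∑ xs f + ∑ ys f)  ≡⟨ +-assoc (f x) _ _ ⟨
  f x + ∑ xs f + ∑ ys f    ∎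
  where open ≡-Reasoning

∑-map : (g : A → B) (xs : List A) (f : B → ℕ) → ∑ (map g xs) f ≡ ∑ xs (λ x → f (g x))
∑-map g [] f = refl
∑-map g (x ∷ xs) f = cong (f (g x) +_) (∑-map g xs f)

∑-zero : (xs : List A) → ∑ xs (λ _ → 0) ≡ 0
∑-zero [] = refl
∑-zero (x ∷ xs) = ∑-zero xs

∑-+ : (xs : List A) (f g : A → ℕ) → ∑ xs (λ x → f x + g x) ≡ ∑ xs f + ∑ xs g
∑-+ [] f g = refl
∑-+ (x ∷ xs) f g = begin
  f x + g x + ∑ xs (λ y → f y + g y)  ≡⟨ cong (f x + g x +_) (∑-+ xs f g) ⟩
  f x + g x + (∑ xs f + ∑ xs g)       ≡⟨ interchange (f x) (g x) _ _ ⟩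
  f x + ∑ xs f + (g x + ∑ xs g)       ∎
  where open ≡-Reasoning

∑-cartesianProduct : (xs : List A) (ys : List B) (f : A × B → ℕ) →
                     ∑ (cartesianProduct xs ys) f ≡ ∑ xs (λ x → ∑ ys (λ y → f (x , y)))
∑-cartesianProduct [] ys f = refl
∑-cartesianProduct (x ∷ xs) ys f = begin
  ∑ (map (x ,_) ys ++ cartesianProduct xs ys) f
    ≡⟨ ∑-++ (map (x ,_) ys) _ f ⟩
  ∑ (map (x ,_) ys) f + ∑ (cartesianProduct xs ys) f
    ≡⟨ cong₂ _+_ (∑-map (x ,_) ys f) (∑-cartesianProduct xs ys f) ⟩
  ∑ ys (λ y → f (x , y)) + ∑ xs (λ x′ → ∑ ys (λ y → f (x′ , y)))
    ∎
  where open ≡-Reasoning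

∑-swap : (xs : List A) (ys : List B) (f : A → B → ℕ) →
         ∑ xs (λ x → ∑ ys (f x)) ≡ ∑ ys (λ y → ∑ xs (λ x → f x y))
∑-swap [] ys f = sym (∑-zero ys)
∑-swap (x ∷ xs) ys f = begin
  ∑ ys (f x) + ∑ xs (λ x′ → ∑ ys (f x′))        ≡⟨ cong (∑ ys (f x) +_) (∑-swap xs ys f) ⟩
  ∑ ys (f x) + ∑ ys (λ y → ∑ xs (λ x′ → f x′ y)) ≡⟨ ∑-+ ys (f x) _ ⟨
  ∑ ys (λ y → f x y + ∑ xs (λ x′ → f x′ y))      ∎
  where open ≡-Reasoning

∑≤length*max : (xs : List A) (f : A → ℕ) → ∑ xs f ≤ length xs * foldr _⊔_ 0 (map f xs)
∑≤length*max [] f = z≤n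
∑≤length*max (x ∷ xs) f =
  +-mono-≤ (m≤m⊔n (f x) maxRest)
           (≤-trans (∑≤length*max xs f) (*-monoʳ-≤ (length xs) (m≤n⊔m (f x) maxRest)))
  where maxRest = foldr _⊔_ 0 (map f xs)

edge⇒crossing : ∀ {n} (π : Fin n → Fin n) (i j : Fin n) → IsEdge π (i , j) → InC π j i
edge⇒crossing π i j (i<πi , _ , i<j , j≤πi) = i<πi , <⇒≤ i<j , j≤πi

edges≤∑cardC : ∀ {n} (π : Fin n → Fin n) → edges π ≤ ∑ (allFin n) (cardC π)
edges≤∑cardC {n} π = begin
  edges π
    ≡⟨ length-filter≡∑𝟙 (isEdge? π) (cartesianProduct points points) ⟩
  ∑ (cartesianProduct points points) (λ e → 𝟙 (isEdge? π e))
    ≡⟨ ∑-cartesianProduct points points _ ⟩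
  ∑ points (λ i → ∑ points (λ j → 𝟙 (isEdge? π (i , j))))
    ≡⟨ ∑-swap points points (λ i j → 𝟙 (isEdge? π (i , j))) ⟩
  ∑ points (λ j → ∑ points (λ i → 𝟙 (isEdge? π (i , j))))
    ≤⟨ ∑-mono points (λ j → ∑-mono points (λ i →
         𝟙-mono (isEdge? π (i , j)) (inC? π j i) (edge⇒crossing π i j))) ⟩
  ∑ points (λ j → ∑ points (λ i → 𝟙 (inC? π j i)))
    ≡⟨ ∑-cong points (λ j → length-filter≡∑𝟙 (inC? π j) points) ⟨
  ∑ points (cardC π)
    ∎
  where
  open ≤-Reasoning
  points = allFin n

∑cardC≤n*cut : ∀ {n} (π : Fin n → Fin n) → ∑ (allFin n) (cardC π) ≤ n * cut π
∑cardC≤n*cut {n} π = begin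
  ∑ (allFin n) (cardC π)        ≤⟨ ∑≤length*max (allFin n) (cardC π) ⟩
  length (allFin n) * cut π     ≡⟨ cong (_* cut π) (length-tabulate {n = n} id) ⟩
  n * cut π                     ∎
  where open ≤-Reasoning

lemma4 : (n m : ℕ) → n ≡ 2 * m → (π : Fin n → Fin n) →
    IsInvolution π → FixedPointFree π →
    (l : ℕ) → edges π ≡ l → l ≤ n * cut π
lemma4 n _ _ π _ _ _ refl = ≤-trans (edges≤∑cardC π) (∑cardC≤n*cut π)
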